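{- Let $D$ be a D-graph and let $x,y,z$ be distinct $E$-vertices of $D$. If $\psi_E(x,y,z)$ and $\psi_E(y,x,z)$, then there is a vertex $v$ of $D$ such that $v\rhd[z,x]$, $v\rhd[z,y]$, $v\prec x$ and $v\prec y$.
   Context: A graph is a pair of functions $W,E\colon A\to V$ with $A\cap V=\emptyset$. A vertex $v$ is a $W$-vertex if no edge $a$ has $E(a)=v$, an $E$-vertex if no edge $a$ has $W(a)=v$, and inner if it is neither. An edge $a$ is a $W$-edge if $W(a)$ is a $W$-vertex, an $E$-edge if $E(a)$ is an $E$-vertex. $W$-$E$-functional: for every $W$-edge $a$ and edge $b\ne a$, $W(a)\ne W(b)$, and for every $E$-edge $a$ and $b\ne a$, $E(a)\ne E(b)$. A semipath from $v_0$ to $v_n$ is $v_0a_1v_1\dots a_nv_n$ ($n\ge0$) with $\{W(a_i),E(a_i)\}=\{v_{i-1},v_i\}$ and no repeated vertex; weakly connected: any two distinct vertices joined by a semipath; a cycle is a directed closed walk $v_0a_1\dots a_nv_n$, $n\ge1$, $W(a_i)=v_{i-1}$, $E(a_i)=v_i$, vertices distinct except $v_0=v_n$. A D-graph is a finite, acyclic, $W$-$E$-functional, weakly connected graph with an inner vertex. For vertices $u,v$, $[u,v]$ is the set of semipaths from $u$ to $v$; $[u]_W$ is the set of semipaths from $u$ to some $W$-vertex. Two semipaths intersect if they share a vertex. For distinct $E$-vertices $u,v,w$, $\psi_E(v,u,w)$ means every semipath in $[v,w]$ intersects every semipath in $[u]_W$. $v\rhd[x,z]$ means $v$ occurs in every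 semipath in $[x,z]$. $v\prec x$ means $v\ne x$ and $v$ occurs in every semipath in $[x]_W$. -}

module Defs where

open import Data.Nat using (ℕ)
open import Data.Fin using (Fin)
open import Data.List using (List; []; _∷_)
open import Data.List.Membership.Propositional using (_∈_)
open import Data.List.Relation.Unary.Unique.Propositional using (Unique)
open import Data.Product using (Σ; ∃; _×_; _,_)
open import Data.Sum using (_⊎_)
open import Relation.Nullary using (¬_)
open import Relation.Binary.PropositionalEquality using (_≡_; _≢_)

record Graph : Set where
  field
    nV nA : ℕ
    W E   : Fin nA → Fin nV

module _ (G : Graph) where
  open Graph G

  Vtx : Set
  Vtx = Fin nV

  Edge : Set
  Edge = Fin nA

  IsWVertex : Vtx → Set
  IsWVertex v = ∀ (a : Edge) → E a ≢ v

  IsEVertex : Vtx → Set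
  IsEVertex v = ∀ (a : Edge) → W a ≢ v

  IsInner : Vtx → Set
  IsInner v = ¬ IsWVertex v × ¬ IsEVertex v

  IsWEdge : Edge → Set
  IsWEdge a = IsWVertex (W a)

  IsEEdge : Edge → Set
  IsEEdge a = IsEVertex (E a)

  WEFunctional : Set
  WEFunctional =
    (∀ (a : Edge) → IsWEdge a → ∀ (b : Edge) → b ≢ a → W a ≢ W b) ×
    (∀ (a : Edge) → IsEEdge a → ∀ (b : Edge) → b ≢ a → E a ≢ E b)

  Link : Edge → Vtx → Vtx → Set
  Link a u v = (W a ≡ u × E a ≡ v) ⊎ (W a ≡ v × E a ≡ u)

  data UWalk : Vtx → Vtx → Set where
    stop : (v : Vtx) → UWalk v v
    step : {u v w : Vtx} (a : Edge) → Link a u v → UWalk v w → UWalk u w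

  uverts : {u w : Vtx} → UWalk u w → List Vtx
  uverts (stop v) = v ∷ []
  uverts (step {u = u} a _ p) = u ∷ uverts p

  Semipath : Vtx → Vtx → Set
  Semipath u v = Σ (UWalk u v) (λ p → Unique (uverts p))

  spVerts : {u v : Vtx} → Semipath u v → List Vtx
  spVerts (p , _) = uverts p

  data DWalk : Vtx → Vtx → Set where
    dstop : (v : Vtx) → DWalk v v
    dstep : {w : Vtx} (a : Edge) → DWalk (E a) w → DWalk (W a) w

  dverts : {u w : Vtx} → DWalk u w → List Vtx
  dverts (dstop v) = v ∷ []
  dverts (dstep a p) = W a ∷ dverts p

  -- a cycle v₀ a₁ v₁ … aₙ vₙ (n ≥ 1, vᵢ = E(aᵢ), W(aᵢ) = v_{i-1}),
  -- v₀ = vₙ, and v₁,…,vₙ pairwise distinct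
  Cycle : Set
  Cycle = Σ Edge (λ a → Σ (DWalk (E a) (W a)) (λ p → Unique (dverts p)))

  Acyclic : Set
  Acyclic = ¬ Cycle

  WeaklyConnected : Set
  WeaklyConnected = ∀ (u v : Vtx) → u ≢ v → Semipath u v

  IsDGraph : Set
  IsDGraph = Acyclic × WEFunctional × WeaklyConnected × ∃ IsInner

  Intersect : {u v u' v' : Vtx} → Semipath u v → Semipath u' v' → Set
  Intersect p q = ∃ λ x → x ∈ spVerts p × x ∈ spVerts q

  ψE : Vtx → Vtx → Vtx → Set
  ψE v u w = (p : Semipath v w) → (t : Vtx) → IsWVertex t →
             (q : Semipath u t) → Intersect p q

  _▷[_,_] : Vtx → Vtx → Vtx → Set
  v ▷[ x , z ] = (p : Semipath x z) → v ∈ spVerts p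

  _≺_ : Vtx → Vtx → Set
  v ≺ x = v ≢ x × ((t : Vtx) → IsWVertex t → (q : Semipath x t) → v ∈ spVerts q)

-- Let T consist of z and the W-vertices. In any finite graph, two sources s₁, s₂ satisfy a
-- Menger-type dichotomy: some vertex lies on every walk from s₁ into T and on every walk from
-- s₂ into T, or there are vertex-disjoint walks from s₁ and from s₂ into T. It is proved by
-- augmentation: maintain a tripod (legs from s₁ and s₂ to a centre, a stem from the centre into
-- T, meeting only at the centre); if the centre separates neither source from T we are done,
-- otherwise a walk avoiding it either gives disjoint routes or regrafts the tripod onto a strictly
-- shorter stem.
--
-- For s₁ = x, s₂ = y a separator v is the required vertex; v ≠ x because v lies on a semipath
-- from y to z while an E-vertex of a W-E-functional graph has a single edge and so is interior to
-- no semipath. Disjoint routes cannot exist: a route ending at z contradicts ψ_E directly, and if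
-- both end at W-vertices, a semipath from z to x followed until it first meets a route turns that
-- route into one ending at z.

module Submission where

open import Defs
open import Data.Nat using (ℕ; zero; suc; _≤_; _<_; z≤n; s≤s)
open import Data.Nat.Properties using (≤-trans; ≤-refl; n≤1+n)
open import Data.Nat.Induction using (<-wellFounded)
open import Induction.WellFounded using (Acc; acc)
open import Data.Fin.Properties using (_≟_; any?; all?)
open import Data.List using (List; []; _∷_; length; filter; allFin)
open import Data.List.Properties using (filter-notAll)
open import Data.List.Membership.Propositional using (_∈_; _∉_)
open import Data.List.Membership.Propositional.Properties using (∈-filter⁺; ∈-allFin)
open import Data.List.Relation.Unary.Any as Any using (here; there)
open import Data.List.Relation.Unary.All as All using ([]; _∷_)
open import Data.List.Relation.Unary.All.Properties using (¬Any⇒All¬)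
open import Data.List.Relation.Unary.AllPairs using ([]; _∷_)
open import Data.List.Relation.Unary.Unique.Propositional using (Unique)
open import Data.List.Relation.Unary.Unique.Propositional.Properties using (Unique[x∷xs]⇒x∉xs)
open import Data.List.Relation.Binary.Subset.Propositional using (_⊆_)
open import Data.List.Relation.Binary.Disjoint.Propositional using (Disjoint)
open import Data.Product using (Σ; ∃; _×_; _,_; proj₁; proj₂)
open import Data.Sum using (_⊎_; inj₁; inj₂; swap)
open import Data.Empty using (⊥; ⊥-elim)
open import Function using (_∘_)
open import Relation.Nullary using (¬_; Dec; yes; no)
open import Relation.Nullary.Decidable using (_×-dec_; _⊎-dec_; ¬?)
open import Relation.Unary using (Decidable)
open import Relation.Binary.Definitions using (DecidableEquality)
open import Relation.Binary.PropositionalEquality using (_≡_; _≢_; refl; sym; trans; subst)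

unique-length-≤ : {A : Set} → DecidableEquality A → {xs ys : List A} →
                  Unique xs → xs ⊆ ys → length xs ≤ length ys
unique-length-≤ _≟ₐ_ {[]} _ _ = z≤n
unique-length-≤ _≟ₐ_ {x ∷ xs} {ys} (x∉xs ∷ uxs) xs⊆ys =
  ≤-trans (s≤s (unique-length-≤ _≟ₐ_ uxs xs⊆ys-x))
          (filter-notAll (¬? ∘ (x ≟ₐ_)) ys (Any.map (λ x≡y x≢y → x≢y x≡y) (xs⊆ys (here refl))))
  where
    xs⊆ys-x : xs ⊆ filter (¬? ∘ (x ≟ₐ_)) ys
    xs⊆ys-x y∈xs = ∈-filter⁺ (¬? ∘ (x ≟ₐ_)) (xs⊆ys (there y∈xs)) (All.lookup x∉xs y∈xs)

MeetOnlyAt : {A : Set} → A → List A → List A → Set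
MeetOnlyAt p xs ys = ∀ {v} → v ∈ xs → v ∈ ys → v ≡ p

module Walks (G : Graph) where
  open Graph G
  open import Data.List.Membership.DecPropositional (_≟_ {nV}) using (_∈?_)

  Walk : Vtx G → Vtx G → Set
  Walk = UWalk G

  verts : ∀ {u v} → Walk u v → List (Vtx G)
  verts = uverts G

  source∈ : ∀ {u v} (q : Walk u v) → u ∈ verts q
  source∈ (stop _)     = here refl
  source∈ (step _ _ _) = here refl

  target∈ : ∀ {u v} (q : Walk u v) → v ∈ verts q
  target∈ (stop _)     = here refl
  target∈ (step _ _ q) = there (target∈ q)

  infixr 5 _++ʷ_
  _++ʷ_ : ∀ {u v w} → Walk u v → Walk v w → Walk u w
  stop _     ++ʷ r = r
  step a l q ++ʷ r = step a l (q ++ʷ r)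

  ∈-++ʷ⁻ : ∀ {u v w x} (q : Walk u v) {r : Walk v w} →
           x ∈ verts (q ++ʷ r) → x ∈ verts q ⊎ x ∈ verts r
  ∈-++ʷ⁻ (stop _)     x∈r         = inj₂ x∈r
  ∈-++ʷ⁻ (step _ _ _) (here refl) = inj₁ (here refl)
  ∈-++ʷ⁻ (step _ _ q) (there x∈)  = Data.Sum.map₁ there (∈-++ʷ⁻ q x∈)

  reverse : ∀ {u v} → Walk u v → Walk v u
  reverse (stop v)         = stop v
  reverse (step {u} a l q) = reverse q ++ʷ step a (swap l) (stop u)

  reverse-⊆ : ∀ {u v} (q : Walk u v) → verts (reverse q) ⊆ verts q
  reverse-⊆ (stop _)     x∈ = x∈
  reverse-⊆ (step _ _ q) x∈ with ∈-++ʷ⁻ (reverse q) x∈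
  ... | inj₁ x∈q              = there (reverse-⊆ q x∈q)
  ... | inj₂ (here refl)      = there (source∈ q)
  ... | inj₂ (there (here refl)) = here refl

  takeTo : ∀ {u v w} (q : Walk u v) → w ∈ verts q → Walk u w
  takeTo (stop v)         (here refl) = stop v
  takeTo (step {u} _ _ _) (here refl) = stop u
  takeTo (step a l q)     (there w∈)  = step a l (takeTo q w∈)

  dropTo : ∀ {u v w} (q : Walk u v) → w ∈ verts q → Walk w v
  dropTo (stop v)     (here refl) = stop v
  dropTo (step a l q) (here refl) = step a l q
  dropTo (step _ _ q) (there w∈)  = dropTo q w∈

  takeTo-⊆ : ∀ {u v w} (q : Walk u v) (w∈ : w ∈ verts q) → verts (takeTo q w∈) ⊆ verts q
  takeTo-⊆ (stop _)     (here refl) x∈          = x∈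
  takeTo-⊆ (step _ _ _) (here refl) (here refl) = here refl
  takeTo-⊆ (step _ _ _) (there _)   (here refl) = here refl
  takeTo-⊆ (step _ _ q) (there w∈)  (there x∈)  = there (takeTo-⊆ q w∈ x∈)

  dropTo-⊆ : ∀ {u v w} (q : Walk u v) (w∈ : w ∈ verts q) → verts (dropTo q w∈) ⊆ verts q
  dropTo-⊆ (stop _)     (here refl) x∈ = x∈
  dropTo-⊆ (step _ _ _) (here refl) x∈ = x∈
  dropTo-⊆ (step _ _ q) (there w∈)  x∈ = there (dropTo-⊆ q w∈ x∈)

  dropTo-unique : ∀ {u v w} (q : Walk u v) (w∈ : w ∈ verts q) →
                  Unique (verts q) → Unique (verts (dropTo q w∈))
  dropTo-unique (stop _)     (here refl) uq        = uq
  dropTo-unique (step _ _ _) (here refl) uq        = uq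
  dropTo-unique (step _ _ q) (there w∈)  (_ ∷ uq) = dropTo-unique q w∈ uq

  takeTo-dropTo-meet : ∀ {u v w} (q : Walk u v) (w∈ : w ∈ verts q) → Unique (verts q) →
                       MeetOnlyAt w (verts (takeTo q w∈)) (verts (dropTo q w∈))
  takeTo-dropTo-meet (stop _)     (here refl) _  (here refl) _  = refl
  takeTo-dropTo-meet (step _ _ _) (here refl) _  (here refl) _  = refl
  takeTo-dropTo-meet (step _ _ q) (there w∈)  uq (here refl) x∈ =
    ⊥-elim (Unique[x∷xs]⇒x∉xs uq (dropTo-⊆ q w∈ x∈))
  takeTo-dropTo-meet (step _ _ q) (there w∈)  (_ ∷ uq) (there x∈) y∈ =
    takeTo-dropTo-meet q w∈ uq x∈ y∈

  dropTo-shorter : ∀ {u v w} (q : Walk u v) (w∈ : w ∈ verts q) → w ≢ u →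
                   length (verts (dropTo q w∈)) < length (verts q)
  dropTo-shorter (stop _)     (here refl) w≢u = ⊥-elim (w≢u refl)
  dropTo-shorter (step _ _ _) (here refl) w≢u = ⊥-elim (w≢u refl)
  dropTo-shorter (step _ _ q) (there w∈)  _   = s≤s (dropTo-length q w∈)
    where
      dropTo-length : ∀ {u v w} (q : Walk u v) (w∈ : w ∈ verts q) →
                      length (verts (dropTo q w∈)) ≤ length (verts q)
      dropTo-length (stop _)     (here refl) = ≤-refl
      dropTo-length (step _ _ _) (here refl) = ≤-refl
      dropTo-length (step _ _ q) (there w∈)  = ≤-trans (dropTo-length q w∈) (n≤1+n _)

  record LoopErased {u v} (q : Walk u v) : Set where
    field
      path   : Walk u v
      unique : Unique (verts path)
      ⊆walk  : verts path ⊆ verts q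

  loopErase : ∀ {u v} (q : Walk u v) → LoopErased q
  loopErase (stop v) = record { path = stop v ; unique = [] ∷ [] ; ⊆walk = λ x∈ → x∈ }
  loopErase (step {u} a l q) with loopErase q
  ... | record { path = r ; unique = ur ; ⊆walk = r⊆q } with u ∈? verts r
  ...   | yes u∈r = record
          { path = dropTo r u∈r ; unique = dropTo-unique r u∈r ur ; ⊆walk = there ∘ r⊆q ∘ dropTo-⊆ r u∈r }
  ...   | no  u∉r = record
          { path = step a l r ; unique = ¬Any⇒All¬ (verts r) u∉r ∷ ur
          ; ⊆walk = λ { (here refl) → here refl ; (there x∈) → there (r⊆q x∈) } }

  module _ {P : Vtx G → Set} (P? : Decidable P) where

    record FirstHit {u v} (q : Walk u v) : Set where
      field
        hit      : Vtx G
        hit-P    : P hit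
        prefix   : Walk u hit
        prefix-⊆ : verts prefix ⊆ verts q
        first    : ∀ {x} → x ∈ verts prefix → P x → x ≡ hit

    firstHit : ∀ {u v} (q : Walk u v) → P v → FirstHit q
    firstHit (stop v) Pv = record
      { hit = v ; hit-P = Pv ; prefix = stop v ; prefix-⊆ = λ x∈ → x∈ ; first = λ { (here refl) _ → refl } }
    firstHit (step {u} a l q) Pv with P? u
    ... | yes Pu = record
      { hit = u ; hit-P = Pu ; prefix = stop u ; prefix-⊆ = λ { (here refl) → here refl }
      ; first = λ { (here refl) _ → refl } }
    ... | no ¬Pu = record
      { hit = hit ; hit-P = hit-P ; prefix = step a l prefix
      ; prefix-⊆ = λ { (here refl) → here refl ; (there x∈) → there (prefix-⊆ x∈) }
      ; first = λ { (here refl) Pu → ⊥-elim (¬Pu Pu) ; (there x∈) → first x∈ } }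
      where open FirstHit (firstHit q Pv)

    record LastHit {u v} (q : Walk u v) : Set where
      field
        hit      : Vtx G
        hit-P    : P hit
        suffix   : Walk hit v
        suffix-⊆ : verts suffix ⊆ verts q
        last     : ∀ {x} → x ∈ verts suffix → P x → x ≡ hit

    lastHit : ∀ {u v} (q : Walk u v) → P u → LastHit q
    lastHit q Pu = record
      { hit = hit ; hit-P = hit-P ; suffix = reverse prefix
      ; suffix-⊆ = reverse-⊆ q ∘ prefix-⊆ ∘ reverse-⊆ prefix
      ; last = first ∘ reverse-⊆ prefix }
      where open FirstHit (firstHit (reverse q) Pu)

  detour : ∀ {a t₁ b t₂ z h} (p : Walk a t₁) (q : Walk b t₂) → Disjoint (verts p) (verts q) →
           (h∈p : h ∈ verts p) (back : Walk z h) → MeetOnlyAt h (verts back) (verts q) →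
           Σ (Walk a z) λ p′ → Disjoint (verts p′) (verts q)
  detour {h = h} p q p#q h∈p back back-q =
    takeTo p h∈p ++ʷ reverse back , λ (x∈ , x∈q) → avoids (∈-++ʷ⁻ (takeTo p h∈p) x∈) x∈q
    where
      avoids : ∀ {x} → x ∈ verts (takeTo p h∈p) ⊎ x ∈ verts (reverse back) → x ∉ verts q
      avoids (inj₁ x∈) x∈q = p#q (takeTo-⊆ p h∈p x∈ , x∈q)
      avoids (inj₂ x∈) x∈q with back-q (reverse-⊆ back x∈) x∈q
      ... | refl = p#q (h∈p , x∈q)

  reroute : ∀ {a t₁ b t₂ z} (p : Walk a t₁) (q : Walk b t₂) → Disjoint (verts p) (verts q) →
            Walk z a →
            (Σ (Walk a z) λ p′ → Disjoint (verts p′) (verts q)) ⊎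
            (Σ (Walk b z) λ q′ → Disjoint (verts q′) (verts p))
  reroute {a} {b = b} {z = z} p q p#q back = towards hit-P
    where
      open FirstHit (firstHit (λ x → x ∈? verts p ⊎-dec x ∈? verts q) back (inj₁ (source∈ p)))
      towards : hit ∈ verts p ⊎ hit ∈ verts q →
                (Σ (Walk a z) λ p′ → Disjoint (verts p′) (verts q)) ⊎
                (Σ (Walk b z) λ q′ → Disjoint (verts q′) (verts p))
      towards (inj₁ h∈p) = inj₁ (detour p q p#q h∈p prefix λ x∈ x∈q → first x∈ (inj₂ x∈q))
      towards (inj₂ h∈q) = inj₂ (detour q p (λ (x∈q , x∈p) → p#q (x∈p , x∈q)) h∈q prefix
                                        λ x∈ x∈p → first x∈ (inj₁ x∈p))

module Fan (G : Graph) {T : Vtx G → Set} (T? : Decidable T) where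
  open Graph G
  open Walks G
  open import Data.List.Membership.DecPropositional (_≟_ {nV}) using (_∈?_)

  Escape : Vtx G → Vtx G → Set
  Escape p s = Σ (Vtx G) λ t → T t × Σ (Walk s t) λ q → p ∉ verts q

  _separates_ : Vtx G → Vtx G → Set
  v separates s = ∀ {t} → T t → (q : Walk s t) → v ∈ verts q

  link? : ∀ a u v → Dec (Link G a u v)
  link? a u v = ((W a ≟ u) ×-dec (E a ≟ v)) ⊎-dec ((W a ≟ v) ×-dec (E a ≟ u))

  ShortEscape : ℕ → Vtx G → Vtx G → Set
  ShortEscape k p s = Σ (Vtx G) λ t → T t × Σ (Walk s t) λ q → p ∉ verts q × length (verts q) ≤ k

  shortEscape? : ∀ k p s → Dec (ShortEscape k p s)
  shortEscape? zero p s = no λ { (_ , _ , stop _ , _ , ()) ; (_ , _ , step _ _ _ , _ , ()) }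
  shortEscape? (suc k) p s with s ≟ p
  ... | yes refl = no λ (_ , _ , q , p∉q , _) → p∉q (source∈ q)
  ... | no s≢p with T? s
  ...   | yes Ts = yes (s , Ts , stop s , (λ { (here p≡s) → s≢p (sym p≡s) }) , s≤s z≤n)
  ...   | no ¬Ts with any? (λ a → any? (λ v → link? a s v ×-dec shortEscape? k p v))
  ...     | yes (a , v , l , t , Tt , q , p∉q , short) =
              yes (t , Tt , step a l q , (λ { (here p≡s) → s≢p (sym p≡s) ; (there p∈q) → p∉q p∈q }) ,
                   s≤s short)
  ...     | no ¬next = no λ
              { (_ , Tt , stop _ , _ , _) → ¬Ts Tt
              ; (t , Tt , step a l q , p∉ , s≤s short) → ¬next (a , _ , l , t , Tt , q , p∉ ∘ there , short) }

  -- Walks with at most nV vertices suffice: loop erasure keeps a walk inside its own vertex set.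
  escape-or-separates : ∀ p s → Escape p s ⊎ p separates s
  escape-or-separates p s with shortEscape? (length (allFin nV)) p s
  ... | yes (t , Tt , q , p∉q , _) = inj₁ (t , Tt , q , p∉q)
  ... | no ¬short = inj₂ on-every-walk
    where
      on-every-walk : p separates s
      on-every-walk Tt q with p ∈? verts q
      ... | yes p∈q = p∈q
      ... | no p∉q =
        ⊥-elim (¬short (_ , Tt , path , p∉q ∘ ⊆walk , unique-length-≤ _≟_ unique λ {x} _ → ∈-allFin x))
        where open LoopErased (loopErase q)

  record DisjointRoutes (s₁ s₂ : Vtx G) : Set where
    field
      end₁ end₂ : Vtx G
      end₁-T    : T end₁
      end₂-T    : T end₂
      route₁    : Walk s₁ end₁
      route₂    : Walk s₂ end₂
      disjoint  : Disjoint (verts route₁) (verts route₂)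

  Outcome : Vtx G → Vtx G → Set
  Outcome s₁ s₂ = (∃ λ v → v separates s₁ × v separates s₂) ⊎ DisjointRoutes s₁ s₂

  swapOutcome : ∀ {s₁ s₂} → Outcome s₂ s₁ → Outcome s₁ s₂
  swapOutcome (inj₁ (v , sep₂ , sep₁)) = inj₁ (v , sep₁ , sep₂)
  swapOutcome (inj₂ r) = inj₂ record
    { end₁ = end₂ ; end₂ = end₁ ; end₁-T = end₂-T ; end₂-T = end₁-T ; route₁ = route₂ ; route₂ = route₁
    ; disjoint = λ (x∈₂ , x∈₁) → disjoint (x∈₁ , x∈₂) }
    where open DisjointRoutes r

  record Tripod (s₁ s₂ : Vtx G) : Set where
    field
      centre end     : Vtx G
      end-T          : T end
      leg₁           : Walk s₁ centre
      leg₂           : Walk s₂ centre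
      stem           : Walk centre end
      leg₁-unique    : Unique (verts leg₁)
      leg₂-unique    : Unique (verts leg₂)
      stem-unique    : Unique (verts stem)
      legs-meet      : MeetOnlyAt centre (verts leg₁) (verts leg₂)
      leg₁-stem-meet : MeetOnlyAt centre (verts leg₁) (verts stem)
      leg₂-stem-meet : MeetOnlyAt centre (verts leg₂) (verts stem)

    stemLength : ℕ
    stemLength = length (verts stem)

  swapTripod : ∀ {s₁ s₂} → Tripod s₁ s₂ → Tripod s₂ s₁
  swapTripod τ = record
    { centre = centre ; end = end ; end-T = end-T ; leg₁ = leg₂ ; leg₂ = leg₁ ; stem = stem
    ; leg₁-unique = leg₂-unique ; leg₂-unique = leg₁-unique ; stem-unique = stem-unique
    ; legs-meet = λ x∈₂ x∈₁ → legs-meet x∈₁ x∈₂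
    ; leg₁-stem-meet = leg₂-stem-meet ; leg₂-stem-meet = leg₁-stem-meet }
    where open Tripod τ

  Progress : ∀ {s₁ s₂} → Tripod s₁ s₂ → Set
  Progress {s₁} {s₂} τ =
    Outcome s₁ s₂ ⊎ Σ (Tripod s₁ s₂) λ τ′ → Tripod.stemLength τ′ < Tripod.stemLength τ

  swapProgress : ∀ {s₁ s₂} (τ : Tripod s₁ s₂) → Progress (swapTripod τ) → Progress τ
  swapProgress τ (inj₁ o)         = inj₁ (swapOutcome o)
  swapProgress τ (inj₂ (τ′ , lt)) = inj₂ (swapTripod τ′ , lt)

  module _ {s₁ s₂} (τ : Tripod s₁ s₂) where
    open Tripod τ

    module _ {w e} (w∈leg₁ : w ∈ verts leg₁) (b : Walk w e) (centre∉b : centre ∉ verts b)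
             (b-legs : ∀ {x} → x ∈ verts b → x ∈ verts leg₁ ⊎ x ∈ verts leg₂ → x ≡ w)
             (b-stem : MeetOnlyAt e (verts b) (verts stem)) where

      private
        pre : Walk s₁ w
        pre = takeTo leg₁ w∈leg₁

        centre∉pre : centre ∉ verts pre
        centre∉pre c∈pre
          with takeTo-dropTo-meet leg₁ w∈leg₁ leg₁-unique c∈pre (target∈ (dropTo leg₁ w∈leg₁))
        ... | refl = centre∉b (source∈ b)

        pre#leg₂ : Disjoint (verts pre) (verts leg₂)
        pre#leg₂ (x∈pre , x∈leg₂) with legs-meet (takeTo-⊆ leg₁ w∈leg₁ x∈pre) x∈leg₂
        ... | refl = centre∉pre x∈pre

        pre#stem : Disjoint (verts pre) (verts stem)
        pre#stem (x∈pre , x∈stem) with leg₁-stem-meet (takeTo-⊆ leg₁ w∈leg₁ x∈pre) x∈stem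
        ... | refl = centre∉pre x∈pre

        b#leg₂ : Disjoint (verts b) (verts leg₂)
        b#leg₂ (x∈b , x∈leg₂) with b-legs x∈b (inj₂ x∈leg₂)
        ... | refl with legs-meet w∈leg₁ x∈leg₂
        ...   | refl = centre∉b x∈b

        routes : e ∉ verts stem → T e → DisjointRoutes s₁ s₂
        routes e∉stem Te = record
          { end₁-T = Te ; end₂-T = end-T ; route₁ = pre ++ʷ b ; route₂ = leg₂ ++ʷ stem
          ; disjoint = λ (x∈₁ , x∈₂) → apart (∈-++ʷ⁻ pre x∈₁) (∈-++ʷ⁻ leg₂ x∈₂) }
          where
            apart : ∀ {x} → x ∈ verts pre ⊎ x ∈ verts b → x ∈ verts leg₂ ⊎ x ∈ verts stem → ⊥
            apart (inj₁ x∈pre) (inj₁ x∈leg₂) = pre#leg₂ (x∈pre , x∈leg₂)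
            apart (inj₁ x∈pre) (inj₂ x∈stem) = pre#stem (x∈pre , x∈stem)
            apart (inj₂ x∈b)   (inj₁ x∈leg₂) = b#leg₂ (x∈b , x∈leg₂)
            apart (inj₂ x∈b)   (inj₂ x∈stem) with b-stem x∈b x∈stem
            ... | refl = e∉stem x∈stem

        regraft : e ∈ verts stem → Σ (Tripod s₁ s₂) λ τ′ → Tripod.stemLength τ′ < stemLength
        regraft e∈stem = τ′ , dropTo-shorter stem e∈stem e≢centre
          where
            seg : Walk centre e
            seg = takeTo stem e∈stem

            stem′ : Walk e end
            stem′ = dropTo stem e∈stem

            open LoopErased (loopErase (pre ++ʷ b))
              renaming (path to leg₁′; unique to leg₁′-unique; ⊆walk to leg₁′-⊆)
            open LoopErased (loopErase (leg₂ ++ʷ seg))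
              renaming (path to leg₂′; unique to leg₂′-unique; ⊆walk to leg₂′-⊆)

            e≢centre : e ≢ centre
            e≢centre refl = centre∉b (target∈ b)

            seg-stem′-meet : MeetOnlyAt e (verts seg) (verts stem′)
            seg-stem′-meet = takeTo-dropTo-meet stem e∈stem stem-unique

            centre∉stem′ : centre ∉ verts stem′
            centre∉stem′ c∈ = e≢centre (sym (seg-stem′-meet (source∈ seg) c∈))

            on-leg₁′ : ∀ {x} → x ∈ verts leg₁′ → x ∈ verts pre ⊎ x ∈ verts b
            on-leg₁′ = ∈-++ʷ⁻ pre ∘ leg₁′-⊆

            on-leg₂′ : ∀ {x} → x ∈ verts leg₂′ → x ∈ verts leg₂ ⊎ x ∈ verts seg
            on-leg₂′ = ∈-++ʷ⁻ leg₂ ∘ leg₂′-⊆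

            legs-meet′ : ∀ {x} → x ∈ verts pre ⊎ x ∈ verts b → x ∈ verts leg₂ ⊎ x ∈ verts seg → x ≡ e
            legs-meet′ (inj₁ x∈pre) (inj₁ x∈leg₂) = ⊥-elim (pre#leg₂ (x∈pre , x∈leg₂))
            legs-meet′ (inj₁ x∈pre) (inj₂ x∈seg)  = ⊥-elim (pre#stem (x∈pre , takeTo-⊆ stem e∈stem x∈seg))
            legs-meet′ (inj₂ x∈b)   (inj₁ x∈leg₂) = ⊥-elim (b#leg₂ (x∈b , x∈leg₂))
            legs-meet′ (inj₂ x∈b)   (inj₂ x∈seg)  = b-stem x∈b (takeTo-⊆ stem e∈stem x∈seg)

            leg₁-stem-meet′ : ∀ {x} → x ∈ verts pre ⊎ x ∈ verts b → x ∈ verts stem′ → x ≡ e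
            leg₁-stem-meet′ (inj₁ x∈pre) x∈ = ⊥-elim (pre#stem (x∈pre , dropTo-⊆ stem e∈stem x∈))
            leg₁-stem-meet′ (inj₂ x∈b)   x∈ = b-stem x∈b (dropTo-⊆ stem e∈stem x∈)

            leg₂-stem-meet′ : ∀ {x} → x ∈ verts leg₂ ⊎ x ∈ verts seg → x ∈ verts stem′ → x ≡ e
            leg₂-stem-meet′ (inj₁ x∈leg₂) x∈ with leg₂-stem-meet x∈leg₂ (dropTo-⊆ stem e∈stem x∈)
            ... | refl = ⊥-elim (centre∉stem′ x∈)
            leg₂-stem-meet′ (inj₂ x∈seg)  x∈ = seg-stem′-meet x∈seg x∈

            τ′ : Tripod s₁ s₂
            τ′ = record
              { end-T = end-T ; leg₁ = leg₁′ ; leg₂ = leg₂′ ; stem = stem′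
              ; leg₁-unique = leg₁′-unique ; leg₂-unique = leg₂′-unique
              ; stem-unique = dropTo-unique stem e∈stem stem-unique
              ; legs-meet = λ x∈₁ x∈₂ → legs-meet′ (on-leg₁′ x∈₁) (on-leg₂′ x∈₂)
              ; leg₁-stem-meet = leg₁-stem-meet′ ∘ on-leg₁′
              ; leg₂-stem-meet = leg₂-stem-meet′ ∘ on-leg₂′ }

      advance : e ∈ verts stem ⊎ T e → Progress τ
      advance lands with e ∈? verts stem | lands
      ... | yes e∈stem | _        = inj₂ (regraft e∈stem)
      ... | no  e∉stem | inj₁ e∈  = ⊥-elim (e∉stem e∈)
      ... | no  e∉stem | inj₂ Te  = inj₁ (inj₂ (routes e∉stem Te))

  augment : ∀ {s₁ s₂} (τ : Tripod s₁ s₂) → Escape (Tripod.centre τ) s₁ → Progress τ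
  augment τ (_ , Tt , q , centre∉q) = from w-P
    where
      open Tripod τ
      open FirstHit (firstHit (λ x → x ∈? verts stem ⊎-dec T? x) q (inj₂ Tt))
      open LastHit (lastHit (λ x → x ∈? verts leg₁ ⊎-dec x ∈? verts leg₂) prefix (inj₁ (source∈ leg₁)))
        renaming (hit to w; hit-P to w-P; suffix to b)

      centre∉b : centre ∉ verts b
      centre∉b = centre∉q ∘ prefix-⊆ ∘ suffix-⊆

      b-stem : MeetOnlyAt hit (verts b) (verts stem)
      b-stem x∈b x∈stem = first (suffix-⊆ x∈b) (inj₁ x∈stem)

      from : w ∈ verts leg₁ ⊎ w ∈ verts leg₂ → Progress τ
      from (inj₁ w∈leg₁) = advance τ w∈leg₁ b centre∉b last b-stem hit-P
      from (inj₂ w∈leg₂) = swapProgress τ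
        (advance (swapTripod τ) w∈leg₂ b centre∉b (λ x∈b → last x∈b ∘ swap) b-stem hit-P)

  improve : ∀ {s₁ s₂} (τ : Tripod s₁ s₂) → Progress τ
  improve {s₁} {s₂} τ
    with escape-or-separates (Tripod.centre τ) s₁ | escape-or-separates (Tripod.centre τ) s₂
  ... | inj₁ esc₁ | _         = augment τ esc₁
  ... | inj₂ _    | inj₁ esc₂ = swapProgress τ (augment (swapTripod τ) esc₂)
  ... | inj₂ sep₁ | inj₂ sep₂ = inj₁ (inj₁ (Tripod.centre τ , sep₁ , sep₂))

  fan : ∀ {s₁ s₂} (τ : Tripod s₁ s₂) → Acc _<_ (Tripod.stemLength τ) → Outcome s₁ s₂
  fan {s₁} {s₂} τ (acc smaller) = proceed (improve τ)
    where
      proceed : Progress τ → Outcome s₁ s₂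
      proceed (inj₁ o)              = o
      proceed (inj₂ (τ′ , shorter)) = fan τ′ (smaller shorter)

  initial : ∀ s₁ s₂ → Outcome s₁ s₂ ⊎ Tripod s₁ s₂
  initial s₁ s₂ with escape-or-separates s₂ s₁ | escape-or-separates s₁ s₂
  ... | inj₂ s₂-sep-s₁ | _ = inj₁ (inj₁ (s₂ , s₂-sep-s₁ , λ _ q → source∈ q))
  ... | inj₁ _ | inj₂ s₁-sep-s₂ = inj₁ (inj₁ (s₁ , (λ _ q → source∈ q) , s₁-sep-s₂))
  ... | inj₁ (_ , T₁ , q₁ , _) | inj₁ (_ , T₂ , q₂ , _) = join hit-P
    where
      open LoopErased (loopErase q₁) renaming (path to r; unique to r-unique)
      open FirstHit (firstHit (λ x → x ∈? verts r ⊎-dec T? x) q₂ (inj₂ T₂))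

      join : hit ∈ verts r ⊎ T hit → Outcome s₁ s₂ ⊎ Tripod s₁ s₂
      join lands with hit ∈? verts r | lands
      ... | yes e∈r | _ = inj₂ record
        { end-T = T₁ ; leg₁ = leg₁ ; leg₂ = leg₂ ; stem = dropTo r e∈r
        ; leg₁-unique = leg₁-unique ; leg₂-unique = leg₂-unique
        ; stem-unique = dropTo-unique r e∈r r-unique
        ; legs-meet = λ x∈₁ x∈₂ → first (leg₂-⊆ x∈₂) (inj₁ (takeTo-⊆ r e∈r (leg₁-⊆ x∈₁)))
        ; leg₁-stem-meet = takeTo-dropTo-meet r e∈r r-unique ∘ leg₁-⊆
        ; leg₂-stem-meet = λ x∈₂ x∈ → first (leg₂-⊆ x∈₂) (inj₁ (dropTo-⊆ r e∈r x∈)) }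
        where
          open LoopErased (loopErase (takeTo r e∈r))
            renaming (path to leg₁; unique to leg₁-unique; ⊆walk to leg₁-⊆)
          open LoopErased (loopErase prefix)
            renaming (path to leg₂; unique to leg₂-unique; ⊆walk to leg₂-⊆)
      ... | no e∉r | inj₁ e∈r = ⊥-elim (e∉r e∈r)
      ... | no e∉r | inj₂ Te  = inj₁ (inj₂ record
        { end₁-T = T₁ ; end₂-T = Te ; route₁ = r ; route₂ = prefix
        ; disjoint = λ (x∈r , x∈q) → e∉r (subst (_∈ verts r) (first x∈q (inj₁ x∈r)) x∈r) })

  separator-or-disjointRoutes : ∀ s₁ s₂ → Outcome s₁ s₂
  separator-or-disjointRoutes s₁ s₂ with initial s₁ s₂
  ... | inj₁ o = o
  ... | inj₂ τ = fan τ (<-wellFounded _)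

module _ {D : Graph} (functional : WEFunctional D) where
  open Graph D
  open Walks D

  enters : ∀ {a u c} → IsEVertex D c → Link D a u c → W a ≡ u × E a ≡ c
  enters Ec (inj₁ link)        = link
  enters Ec (inj₂ (Wa≡c , _)) = ⊥-elim (Ec _ Wa≡c)

  EVertex-edge-unique : ∀ {c a b} → IsEVertex D c → E a ≡ c → E b ≡ c → a ≡ b
  EVertex-edge-unique {a = a} {b} Ec Ea≡c Eb≡c with b ≟ a
  ... | yes b≡a = sym b≡a
  ... | no  b≢a =
    ⊥-elim (proj₂ functional a (subst (IsEVertex D) (sym Ea≡c) Ec) b b≢a (trans Ea≡c (sym Eb≡c)))

  EVertex-not-interior : ∀ {u v c} (q : Walk u v) → Unique (verts q) → IsEVertex D c →
                         c ∈ verts q → c ≢ u → c ≢ v → ⊥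
  EVertex-not-interior (stop _)     _ _ (here refl) c≢u _ = c≢u refl
  EVertex-not-interior (step _ _ _) _ _ (here refl) c≢u _ = c≢u refl
  EVertex-not-interior (step _ _ (stop _)) _ _ (there (here refl)) _ c≢v = c≢v refl
  EVertex-not-interior (step a l (step b l′ q)) (u∉ ∷ _) Ec (there (here refl)) _ _
    with enters Ec l | enters Ec (swap l′)
  ... | Wa≡u , Ea≡c | Wb≡u₂ , Eb≡c with EVertex-edge-unique Ec Ea≡c Eb≡c
  ...   | refl = All.lookup u∉ (there (subst (_∈ verts q) (trans (sym Wb≡u₂) Wa≡u) (source∈ q))) refl
  EVertex-not-interior (step _ _ q@(step _ _ _)) (_ ∷ uq@(u′∉ ∷ _)) Ec (there (there c∈)) _ c≢v =
    EVertex-not-interior q uq Ec (there c∈) (λ { refl → All.lookup u′∉ c∈ refl }) c≢v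

module _ (D : Graph) (z : Vtx D) where
  open Graph D
  open Walks D

  Target : Vtx D → Set
  Target t = t ≡ z ⊎ IsWVertex D t

  target? : Decidable Target
  target? t = (t ≟ z) ⊎-dec all? (λ a → ¬? (E a ≟ t))

  open Fan D target?

  ψE-meets : ∀ {a b t} → ψE D a b z → (p : Walk a z) (q : Walk b t) → IsWVertex D t →
             ¬ Disjoint (verts p) (verts q)
  ψE-meets ψ p q Wt p#q =
    let (_ , x∈p′ , x∈q′) = ψ (path p′ , unique p′) _ Wt (path q′ , unique q′)
    in p#q (⊆walk p′ x∈p′ , ⊆walk q′ x∈q′)
    where
      open LoopErased
      p′ : LoopErased p
      p′ = loopErase p
      q′ : LoopErased q
      q′ = loopErase q

  target-routes-intersect : ∀ {x y t₁ t₂} → WeaklyConnected D → x ≢ z → ψE D x y z → ψE D y x z →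
                        Target t₁ → Target t₂ → (p : Walk x t₁) (q : Walk y t₂) → ¬ Disjoint (verts p) (verts q)
  target-routes-intersect _ _ _ _ (inj₁ refl) (inj₁ refl) p q p#q = p#q (target∈ p , target∈ q)
  target-routes-intersect _ _ ψ₁ _ (inj₁ refl) (inj₂ Wt₂) p q p#q = ψE-meets ψ₁ p q Wt₂ p#q
  target-routes-intersect _ _ _ ψ₂ (inj₂ Wt₁) (inj₁ refl) p q p#q =
    ψE-meets ψ₂ q p Wt₁ λ (x∈q , x∈p) → p#q (x∈p , x∈q)
  target-routes-intersect {x} connected x≢z ψ₁ ψ₂ (inj₂ Wt₁) (inj₂ Wt₂) p q p#q
    with reroute p q p#q (proj₁ (connected z x (x≢z ∘ sym)))
  ... | inj₁ (p′ , p′#q) = ψE-meets ψ₁ p′ q Wt₂ p′#q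
  ... | inj₂ (q′ , q′#p) = ψE-meets ψ₂ q′ p Wt₁ q′#p

  separates⇒▷ : ∀ {v x} → v separates x → _▷[_,_] D v z x
  separates⇒▷ sep (p , _) = reverse-⊆ p (sep (inj₁ refl) (reverse p))

  separates⇒≺ : ∀ {v x} → v ≢ x → v separates x → _≺_ D v x
  separates⇒≺ v≢x sep = v≢x , λ _ Wt (q , _) → sep (inj₂ Wt) q

  EVertex-¬separates : ∀ {c s} → WEFunctional D → WeaklyConnected D → IsEVertex D c →
                       s ≢ z → c ≢ s → c ≢ z → ¬ (c separates s)
  EVertex-¬separates functional connected Ec s≢z c≢s c≢z sep with connected _ z s≢z
  ... | q , uq = EVertex-not-interior functional q uq Ec (sep (inj₁ refl) q) c≢s c≢z

theorem3p4p1 : (D : Graph) → IsDGraph D →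
    (x y z : Vtx D) → x ≢ y → x ≢ z → y ≢ z →
    IsEVertex D x → IsEVertex D y → IsEVertex D z →
    ψE D x y z → ψE D y x z →
    Σ (Vtx D) (λ v → _▷[_,_] D v z x × _▷[_,_] D v z y × _≺_ D v x × _≺_ D v y)
theorem3p4p1 D (_ , functional , connected , _) x y z x≢y x≢z y≢z Ex Ey _ ψ₁ ψ₂
  with Fan.separator-or-disjointRoutes D (target? D z) x y
... | inj₂ routes = ⊥-elim (target-routes-intersect D z connected x≢z ψ₁ ψ₂ end₁-T end₂-T route₁ route₂ disjoint)
  where open Fan.DisjointRoutes routes
... | inj₁ (v , sep-x , sep-y) =
  v , separates⇒▷ D z sep-x , separates⇒▷ D z sep-y , separates⇒≺ D z v≢x sep-x , separates⇒≺ D z v≢y sep-y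
  where
    v≢x : v ≢ x
    v≢x refl = EVertex-¬separates D z functional connected Ex y≢z x≢y x≢z sep-y
    v≢y : v ≢ y
    v≢y refl = EVertex-¬separates D z functional connected Ey x≢z (x≢y ∘ sym) y≢z sep-x
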